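{- Let $n,m$ be positive integers and let $R_1,\dots,R_n:\{0,\dots,m\}\to\mathbb{R}$ be convex functions with $R_j(0)=0$, indexed so that $R_1(m)\ge R_2(m)\ge\dots\ge R_n(m)$. Let $1\le k\le nm$ with $k\not\equiv 0\pmod m$, and put $q=\lfloor k/m\rfloor$, $r=k\bmod m$. For $i\le q+1$ let $\mathbf{x}^{(i)}$ be the profile assigning $r$ efforts to project $i$, $m$ efforts to every project $j\in\{1,\dots,q+1\}\setminus\{i\}$, and $0$ to all others; for $i>q$ let $\mathbf{x}^{(i)}$ be the profile assigning $r$ efforts to project $i$, $m$ efforts to every project $j\in\{1,\dots,q\}$, and $0$ to all others. Then at least one of $\mathbf{x}^{(1)},\dots,\mathbf{x}^{(n)}$ is an optimal $k$-profile.
   Context: A $k$-profile is a vector $(x_1,\dots,x_n)$ with $x_i\in\{0,\dots,m\}$ and $\sum_i x_i=k$; it is optimal if $\sum_i R_i(x_i)$ is maximum among all $k$-profiles. Convex means $R_j(x+1)-R_j(x)$ is nondecreasing in $x$. (For $i=q+1$ both definitions of $\mathbf{x}^{(i)}$ coincide.)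
   Formalization: The functions $R_1,\dots,R_n$ take only rational values rather than real ones. -}

module Defs where

open import Data.Nat using (ℕ; zero; suc; _≤_; _<_; _≤?_; _<?_)
open import Data.Nat.Properties using (_≟_)
open import Data.Fin using (Fin; toℕ)
import Data.Fin as F
open import Data.Rational using (ℚ; 0ℚ; _+_; _-_) renaming (_≤_ to _≤ℚ_)
open import Data.Bool using (if_then_else_)
open import Data.Product using (_×_)
open import Relation.Nullary.Decidable using (⌊_⌋)
open import Relation.Binary.PropositionalEquality using (_≡_)

sumℕ : ∀ {n} → (Fin n → ℕ) → ℕ
sumℕ {zero}  f = 0
sumℕ {suc n} f = f F.zero Data.Nat.+ sumℕ (λ i → f (F.suc i))

sumℚ : ∀ {n} → (Fin n → ℚ) → ℚ
sumℚ {zero}  f = 0ℚ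
sumℚ {suc n} f = f F.zero + sumℚ (λ i → f (F.suc i))

-- Projects are indexed 0..n-1 (project i of the paper is Fin index i-1).
-- A reward function is given on ℕ; only its values on {0,…,m} matter.

Convex : ℕ → (ℕ → ℚ) → Set
Convex m R = ∀ x → suc (suc x) ≤ m →
  (R (suc x) - R x) ≤ℚ (R (suc (suc x)) - R (suc x))

IsProfile : ∀ {n} → ℕ → ℕ → (Fin n → ℕ) → Set
IsProfile m k x = (∀ i → x i ≤ m) × sumℕ x ≡ k

value : ∀ {n} → (Fin n → ℕ → ℚ) → (Fin n → ℕ) → ℚ
value R x = sumℚ (λ i → R i (x i))

IsOptimal : ∀ {n} → (Fin n → ℕ → ℚ) → ℕ → ℕ → (Fin n → ℕ) → Set
IsOptimal R m k x =
  IsProfile m k x × (∀ y → IsProfile m k y → value R y ≤ℚ value R x)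

-- The profile x^(i) (0-based index i, i.e. paper's project i+1):
-- r to project i; if (paper) i ≤ q+1, i.e. toℕ i ≤ q, then m to every other
-- project with 0-based index ≤ q (paper's {1,…,q+1}); otherwise m to every
-- project with 0-based index < q (paper's {1,…,q}); 0 elsewhere.
xprof : ∀ {n} → ℕ → ℕ → ℕ → Fin n → Fin n → ℕ
xprof m q r i j =
  if ⌊ toℕ j ≟ toℕ i ⌋ then r
  else (if ⌊ toℕ i ≤? q ⌋
        then (if ⌊ toℕ j ≤? q ⌋ then m else 0)
        else (if ⌊ toℕ j <? q ⌋ then m else 0))

-- Shifting effort between two projects while keeping their total fixed changes the value by
-- a convex function of the amount shifted, so one of the two extreme shifts, which leaves one
-- of the projects at 0 or at m, is at least as good.  Repeating this, every profile is dominated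
-- by one with at most one entry strictly between 0 and m; as k ≢ 0 (mod m) that entry is
-- r = k mod m and exactly q = ⌊k/m⌋ other entries equal m.  Because R j m decreases in j, those
-- q full entries are best placed on the first q projects other than the fractional one, which
-- yields x^(i); the best of the x^(i) is therefore optimal.
module Submission where

open import Defs
open import Data.Nat using (ℕ; _≤_; _*_; NonZero)
open import Data.Nat.DivMod using (_/_; _%_)
open import Data.Fin using (Fin; toℕ)
open import Data.Rational using (ℚ; 0ℚ) renaming (_≤_ to _≤ℚ_)
open import Data.Product using (∃)
open import Relation.Binary.PropositionalEquality using (_≡_; _≢_)

open import Algebra.Bundles using (CommutativeMonoid)
import Algebra.Properties.CommutativeSemigroup as CommutativeSemigroupProperties
open import Data.Bool using (true; false; if_then_else_)
open import Data.Bool.Properties using (if-eta)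
open import Data.Empty using (⊥-elim)
open import Data.Fin using (zero; suc)
import Data.Fin.Properties as Fin
open import Data.Nat
  using (zero; suc; _+_; _<_; _≤ᵇ_; _<ᵇ_; _≡ᵇ_; z≤n; s≤s; s≤s⁻¹; _≤?_; _<?_; ≢-nonZero⁻¹)
open import Data.Nat.DivMod
  using (m≡m%n+[m/n]*n; m%n<n; [m+kn]%n≡m%n; n%n≡0; m<n⇒m%n≡m; m<n⇒m/n≡0; m*n/n≡m; +-distrib-/-∣ʳ)
open import Data.Nat.Divisibility using (divides-refl)
import Data.Nat.Properties as ℕ
import Data.Rational as ℚ
import Data.Rational.Properties as ℚ
open import Data.Rational.Solver using (module +-*-Solver)
open import Data.Product using (_×_; _,_; proj₁; proj₂)
open import Data.Sum using (_⊎_; inj₁; inj₂; swap)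
open import Data.Vec.Functional using (_∷_; tail; updateAt)
open import Data.Vec.Functional.Properties using (updateAt-updates; updateAt-minimal)
open import Function using (_∘_; const)
open import Relation.Nullary using (yes; no)
open import Relation.Nullary.Decidable using (isYes≗does)
open import Relation.Binary.PropositionalEquality
  using (refl; sym; trans; cong; cong₂; subst; subst₂; module ≡-Reasoning)

open CommutativeSemigroupProperties ℕ.+-commutativeSemigroup
  using () renaming (x∙yz≈y∙xz to +-rotateℕ)
open CommutativeSemigroupProperties (CommutativeMonoid.commutativeSemigroup ℚ.+-0-commutativeMonoid)
  using () renaming (x∙yz≈y∙xz to +-rotateℚ)

p-q≤r-s⇒s+p≤r+q : ∀ p q r s → p ℚ.- q ≤ℚ r ℚ.- s → s ℚ.+ p ≤ℚ r ℚ.+ q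
p-q≤r-s⇒s+p≤r+q p q r s h = begin
  s ℚ.+ p                  ≡⟨ solve 3 (λ p q s → s :+ p := (p :- q) :+ (s :+ q)) refl p q s ⟩
  (p ℚ.- q) ℚ.+ (s ℚ.+ q)  ≤⟨ ℚ.+-monoˡ-≤ (s ℚ.+ q) h ⟩
  (r ℚ.- s) ℚ.+ (s ℚ.+ q)  ≡⟨ solve 3 (λ q r s → (r :- s) :+ (s :+ q) := r :+ q) refl q r s ⟩
  r ℚ.+ q                  ∎
  where
  open ℚ.≤-Reasoning
  open +-*-Solver

<ᵇ-suc : ∀ a b → (a <ᵇ suc b) ≡ (a ≤ᵇ b)
<ᵇ-suc zero    b = refl
<ᵇ-suc (suc a) b = refl

sumℕ-cong : ∀ {n} {f g : Fin n → ℕ} → (∀ i → f i ≡ g i) → sumℕ f ≡ sumℕ g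
sumℕ-cong {zero}  _   = refl
sumℕ-cong {suc n} f≗g = cong₂ _+_ (f≗g zero) (sumℕ-cong (f≗g ∘ suc))

sumℚ-cong : ∀ {n} {f g : Fin n → ℚ} → (∀ i → f i ≡ g i) → sumℚ f ≡ sumℚ g
sumℚ-cong {zero}  _   = refl
sumℚ-cong {suc n} f≗g = cong₂ ℚ._+_ (f≗g zero) (sumℚ-cong (f≗g ∘ suc))

sumℕ-updateAt : ∀ {n} a b (z : Fin n → ℕ) i v →
                a + z i ≡ b + v → a + sumℕ z ≡ b + sumℕ (updateAt z i (const v))
sumℕ-updateAt a b z zero v e = begin
  a + (z zero + sumℕ (tail z))  ≡⟨ ℕ.+-assoc a (z zero) _ ⟨
  a + z zero + sumℕ (tail z)    ≡⟨ cong (_+ sumℕ (tail z)) e ⟩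
  b + v + sumℕ (tail z)         ≡⟨ ℕ.+-assoc b v _ ⟩
  b + (v + sumℕ (tail z))       ∎
  where open ≡-Reasoning
sumℕ-updateAt a b z (suc i) v e = begin
  a + (z zero + rest)   ≡⟨ +-rotateℕ a (z zero) rest ⟩
  z zero + (a + rest)   ≡⟨ cong (z zero +_) (sumℕ-updateAt a b (tail z) i v e) ⟩
  z zero + (b + rest′)  ≡⟨ +-rotateℕ (z zero) b rest′ ⟩
  b + (z zero + rest′)  ∎
  where
  open ≡-Reasoning
  rest rest′ : ℕ
  rest = sumℕ (tail z)
  rest′ = sumℕ (updateAt (tail z) i (const v))

value-updateAt-≤ : ∀ {n} a b (R : Fin n → ℕ → ℚ) (z : Fin n → ℕ) i v →
                   a ℚ.+ R i (z i) ≤ℚ b ℚ.+ R i v →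
                   a ℚ.+ value R z ≤ℚ b ℚ.+ value R (updateAt z i (const v))
value-updateAt-≤ a b R z zero v h = begin
  a ℚ.+ (R zero (z zero) ℚ.+ rest)  ≡⟨ ℚ.+-assoc a _ rest ⟨
  a ℚ.+ R zero (z zero) ℚ.+ rest    ≤⟨ ℚ.+-monoˡ-≤ rest h ⟩
  b ℚ.+ R zero v ℚ.+ rest           ≡⟨ ℚ.+-assoc b _ rest ⟩
  b ℚ.+ (R zero v ℚ.+ rest)         ∎
  where
  open ℚ.≤-Reasoning
  rest : ℚ
  rest = value (tail R) (tail z)
value-updateAt-≤ a b R z (suc i) v h = begin
  a ℚ.+ (x ℚ.+ rest)   ≡⟨ +-rotateℚ a x rest ⟩
  x ℚ.+ (a ℚ.+ rest)   ≤⟨ ℚ.+-monoʳ-≤ x (value-updateAt-≤ a b (tail R) (tail z) i v h) ⟩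
  x ℚ.+ (b ℚ.+ rest′)  ≡⟨ +-rotateℚ x b rest′ ⟩
  b ℚ.+ (x ℚ.+ rest′)  ∎
  where
  open ℚ.≤-Reasoning
  x rest rest′ : ℚ
  x = R zero (z zero)
  rest = value (tail R) (tail z)
  rest′ = value (tail R) (updateAt (tail z) i (const v))

sumℕ-head : ∀ {n} (w : Fin (suc n) → ℕ) {a} → w zero ≡ a → sumℕ w ≡ a + sumℕ (tail w)
sumℕ-head w = cong (_+ sumℕ (tail w))

value-head : ∀ {n} (R : Fin (suc n) → ℕ → ℚ) (w : Fin (suc n) → ℕ) {a} →
             w zero ≡ a → value R w ≡ R zero a ℚ.+ value (tail R) (tail w)
value-head R w = cong (λ a → R zero a ℚ.+ value (tail R) (tail w))

updateAt-preserves : ∀ {A : Set} (P : A → Set) {n} {z : Fin n → A} i {v} →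
                     (∀ j → j ≢ i → P (z j)) → P v → ∀ j → P (updateAt z i (const v) j)
updateAt-preserves P {z = z} i pz pv j with j Fin.≟ i
... | yes refl = subst P (sym (updateAt-updates j z)) pv
... | no j≢i   = subst P (sym (updateAt-minimal j i z j≢i)) (pz j j≢i)

IsOptimal-resp : ∀ {n} (R : Fin n → ℕ → ℚ) {m k} {x x′ : Fin n → ℕ} →
                 (∀ j → x j ≡ x′ j) → IsOptimal R m k x → IsOptimal R m k x′
IsOptimal-resp R {m} x≗x′ ((x≤m , sum-x) , optimal) =
  ((λ j → subst (_≤ m) (x≗x′ j) (x≤m j)) , trans (sym (sumℕ-cong x≗x′)) sum-x) ,
  λ y y-profile → ℚ.≤-trans (optimal y y-profile)
                            (ℚ.≤-reflexive (sumℚ-cong (λ j → cong (R j) (x≗x′ j))))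

argmax : ∀ {n} (f : Fin (suc n) → ℚ) → ∃ λ i → ∀ j → f j ≤ℚ f i
argmax {zero}  f = zero , λ { zero → ℚ.≤-refl }
argmax {suc n} f with argmax (f ∘ suc)
... | i , f∘suc≤fi with ℚ.≤-total (f zero) (f (suc i))
...   | inj₁ f0≤fi = suc i , λ { zero → f0≤fi ; (suc j) → f∘suc≤fi j }
...   | inj₂ fi≤f0 = zero , λ { zero → ℚ.≤-refl ; (suc j) → ℚ.≤-trans (f∘suc≤fi j) fi≤f0 }

Δ : (ℕ → ℚ) → ℕ → ℚ
Δ R x = R (suc x) ℚ.- R x

module _ (m : ℕ) where

  Extremal : ℕ → Set
  Extremal x = x ≡ 0 ⊎ x ≡ m

  extremal⇒≤ : ∀ {x} → Extremal x → x ≤ m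
  extremal⇒≤ (inj₁ refl) = z≤n
  extremal⇒≤ (inj₂ refl) = ℕ.≤-refl

  record Rebalancing (Ra Rb : ℕ → ℚ) (c d : ℕ) : Set where
    field
      u v          : ℕ
      u≤m          : u ≤ m
      v≤m          : v ≤ m
      conserves    : c + d ≡ u + v
      one-extremal : Extremal u ⊎ Extremal v
      improves     : Ra c ℚ.+ Rb d ≤ℚ Ra u ℚ.+ Rb v

  rebalancing-refl : ∀ {Ra Rb c d} → c ≤ m → d ≤ m → Extremal c ⊎ Extremal d → Rebalancing Ra Rb c d
  rebalancing-refl {c = c} {d} c≤m d≤m extremal = record
    { u = c ; v = d ; u≤m = c≤m ; v≤m = d≤m
    ; conserves = refl ; one-extremal = extremal ; improves = ℚ.≤-refl
    }

  rebalancing-swap : ∀ {Ra Rb c d} → Rebalancing Rb Ra d c → Rebalancing Ra Rb c d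
  rebalancing-swap {Ra} {Rb} {c} {d} o = record
    { u = v ; v = u ; u≤m = v≤m ; v≤m = u≤m
    ; conserves = trans (ℕ.+-comm c d) (trans conserves (ℕ.+-comm u v))
    ; one-extremal = swap one-extremal
    ; improves = subst₂ _≤ℚ_ (ℚ.+-comm (Rb d) (Ra c)) (ℚ.+-comm (Rb u) (Ra v)) improves
    }
    where open Rebalancing o

  rebalancing-step : ∀ {Ra Rb u v} → Δ Rb v ≤ℚ Δ Ra u →
                     Rebalancing Ra Rb (suc u) v → Rebalancing Ra Rb u (suc v)
  rebalancing-step {Ra} {Rb} {u} {v} h o = record
    { u = u′ ; v = v′ ; u≤m = u≤m ; v≤m = v≤m
    ; conserves = trans (ℕ.+-suc u v) conserves
    ; one-extremal = one-extremal
    ; improves = ℚ.≤-trans (p-q≤r-s⇒s+p≤r+q (Rb (suc v)) (Rb v) (Ra (suc u)) (Ra u) h) improves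
    }
    where open Rebalancing o renaming (u to u′; v to v′)

  module _ {Ra Rb : ℕ → ℚ} (convex-a : Convex m Ra) (convex-b : Convex m Rb) where

    -- Once moving one unit from b to a pays off, convexity makes every further such move pay off.
    drain : ∀ u v → suc u ≤ m → suc v ≤ m → Δ Rb v ≤ℚ Δ Ra u → Rebalancing Ra Rb u (suc v)
    drain u zero su≤m _ h = rebalancing-step h (rebalancing-refl su≤m z≤n (inj₂ (inj₁ refl)))
    drain u (suc v) su≤m ssv≤m h with suc u ℕ.≟ m
    ... | yes su≡m = rebalancing-step h (rebalancing-refl su≤m (ℕ.<⇒≤ ssv≤m) (inj₁ (inj₂ su≡m)))
    ... | no su≢m  = rebalancing-step h (drain (suc u) v ssu≤m (ℕ.<⇒≤ ssv≤m) h′)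
      where
      ssu≤m : suc (suc u) ≤ m
      ssu≤m = ℕ.≤∧≢⇒< su≤m su≢m
      h′ : Δ Rb v ≤ℚ Δ Ra (suc u)
      h′ = ℚ.≤-trans (convex-b v ssv≤m) (ℚ.≤-trans h (convex-a u ssu≤m))

  rebalance : ∀ {Ra Rb} → Convex m Ra → Convex m Rb →
              ∀ c d → c ≤ m → d ≤ m → Rebalancing Ra Rb c d
  rebalance _ _ zero    d       c≤m d≤m = rebalancing-refl c≤m d≤m (inj₁ (inj₁ refl))
  rebalance _ _ (suc c) zero    c≤m d≤m = rebalancing-refl c≤m d≤m (inj₂ (inj₁ refl))
  rebalance {Ra} {Rb} convex-a convex-b (suc c) (suc d) c≤m d≤m with suc c ℕ.≟ m | suc d ℕ.≟ m
  ... | yes c≡m | _       = rebalancing-refl c≤m d≤m (inj₁ (inj₂ c≡m))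
  ... | no _    | yes d≡m = rebalancing-refl c≤m d≤m (inj₂ (inj₂ d≡m))
  ... | no c≢m  | no d≢m with ℚ.≤-total (Δ Rb d) (Δ Ra (suc c))
  ...   | inj₁ h = drain convex-a convex-b (suc c) d (ℕ.≤∧≢⇒< c≤m c≢m) d≤m h
  ...   | inj₂ h = rebalancing-swap (drain convex-b convex-a (suc d) c (ℕ.≤∧≢⇒< d≤m d≢m) c≤m h′)
    where
    h′ : Δ Ra c ≤ℚ Δ Rb (suc d)
    h′ = ℚ.≤-trans (convex-a c (ℕ.≤∧≢⇒< c≤m c≢m))
                   (ℚ.≤-trans h (convex-b d (ℕ.≤∧≢⇒< d≤m d≢m)))

  ExtremalExcept : ∀ {n} → Fin n → (Fin n → ℕ) → Set
  ExtremalExcept i z = ∀ j → j ≢ i → Extremal (z j)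

  extremalExcept-tail : ∀ {n} {i : Fin n} {z : Fin (suc n) → ℕ} →
                        ExtremalExcept (suc i) z → ExtremalExcept i (tail z)
  extremalExcept-tail extremal j j≢i = extremal (suc j) (j≢i ∘ Fin.suc-injective)

  record Concentration {n} (R : Fin n → ℕ → ℚ) (y : Fin n → ℕ) : Set where
    field
      profile    : Fin n → ℕ
      fractional : Fin n
      bounded    : ∀ j → profile j ≤ m
      extremal   : ExtremalExcept fractional profile
      total      : sumℕ profile ≡ sumℕ y
      dominates  : value R y ≤ℚ value R profile

  -- The head entry is rebalanced against the fractional entry of the concentrated tail.
  concentrate : ∀ {n} (R : Fin (suc n) → ℕ → ℚ) → (∀ j → Convex m (R j)) →
                (y : Fin (suc n) → ℕ) → (∀ j → y j ≤ m) → Concentration R y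
  concentrate {zero} R convex y y≤m = record
    { profile = y ; fractional = zero ; bounded = y≤m
    ; extremal = λ { zero 0≢0 → ⊥-elim (0≢0 refl) }
    ; total = refl ; dominates = ℚ.≤-refl
    }
  concentrate {suc n} R convex y y≤m = concentrated one-extremal
    where
    open Concentration (concentrate (tail R) (convex ∘ suc) (tail y) (y≤m ∘ suc))
      renaming (profile to z; fractional to i)
    open Rebalancing (rebalance {R zero} {R (suc i)} (convex zero) (convex (suc i))
                                (y zero) (z i) (y≤m zero) (bounded i))

    z⁺ : Fin (suc (suc n)) → ℕ
    z⁺ = u ∷ updateAt z i (const v)

    bounded⁺ : ∀ j → z⁺ j ≤ m
    bounded⁺ zero    = u≤m
    bounded⁺ (suc j) = updateAt-preserves (_≤ m) i (λ j _ → bounded j) v≤m j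

    total⁺ : sumℕ z⁺ ≡ sumℕ y
    total⁺ = sym (trans (cong (y zero +_) (sym total)) (sumℕ-updateAt (y zero) u z i v conserves))

    dominates⁺ : value R y ≤ℚ value R z⁺
    dominates⁺ = ℚ.≤-trans (ℚ.+-monoʳ-≤ (R zero (y zero)) dominates)
                           (value-updateAt-≤ (R zero (y zero)) (R zero u) (tail R) z i v improves)

    concentrated : Extremal u ⊎ Extremal v → Concentration R y
    concentrated (inj₁ u-extremal) = record
      { profile = z⁺ ; fractional = suc i ; bounded = bounded⁺ ; total = total⁺ ; dominates = dominates⁺
      ; extremal = λ where
          zero _ → u-extremal
          (suc j) j≢i → subst Extremal (sym (updateAt-minimal j i z (j≢i ∘ cong suc)))
                                       (extremal j (j≢i ∘ cong suc))
      }
    concentrated (inj₂ v-extremal) = record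
      { profile = z⁺ ; fractional = zero ; bounded = bounded⁺ ; total = total⁺ ; dominates = dominates⁺
      ; extremal = λ where
          zero 0≢0 → ⊥-elim (0≢0 refl)
          (suc j) _ → updateAt-preserves Extremal i extremal v-extremal j
      }

  sumℕ-≤ : ∀ {n} (z : Fin n → ℕ) → (∀ j → z j ≤ m) → sumℕ z ≤ n * m
  sumℕ-≤ {zero}  z _   = z≤n
  sumℕ-≤ {suc n} z z≤m = ℕ.+-mono-≤ (z≤m zero) (sumℕ-≤ (tail z) (z≤m ∘ suc))

  sumℕ-others-≤ : ∀ {n} (z : Fin (suc n) → ℕ) i → (∀ j → z j ≤ m) →
                  sumℕ (updateAt z i (const 0)) ≤ n * m
  sumℕ-others-≤ z zero z≤m = sumℕ-≤ (tail z) (z≤m ∘ suc)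
  sumℕ-others-≤ {suc n} z (suc i) z≤m =
    ℕ.+-mono-≤ (z≤m zero) (sumℕ-others-≤ (tail z) i (z≤m ∘ suc))

  sumℕ-extremal : ∀ {n} (w : Fin n → ℕ) → (∀ j → Extremal (w j)) → ∃ λ c → sumℕ w ≡ c * m
  sumℕ-extremal {zero}  w _ = 0 , refl
  sumℕ-extremal {suc n} w extremal with sumℕ-extremal (tail w) (extremal ∘ suc) | extremal zero
  ... | c , sum | inj₁ w0≡0 = c , cong₂ _+_ w0≡0 sum
  ... | c , sum | inj₂ w0≡m = suc c , cong₂ _+_ w0≡m sum

  record Ranked {n} (R : Fin n → ℕ → ℚ) : Set where
    field
      vanishes   : ∀ j → R j 0 ≡ 0ℚ
      decreasing : ∀ i j → toℕ i ≤ toℕ j → R j m ≤ℚ R i m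

  ranked-tail : ∀ {n} {R : Fin (suc n) → ℕ → ℚ} → Ranked R → Ranked (tail R)
  ranked-tail ranked = record
    { vanishes = vanishes ∘ suc
    ; decreasing = λ i j i≤j → decreasing (suc i) (suc j) (s≤s i≤j)
    }
    where open Ranked ranked

  value-idle-head : ∀ {n} {R : Fin (suc n) → ℕ → ℚ} → Ranked R →
                    (w : Fin (suc n) → ℕ) → w zero ≡ 0 → value R w ≡ value (tail R) (tail w)
  value-idle-head {R = R} ranked w w0≡0 =
    trans (value-head R w w0≡0)
          (trans (cong (ℚ._+ value (tail R) (tail w)) (Ranked.vanishes ranked zero)) (ℚ.+-identityˡ _))

  full : ∀ {n} → ℕ → Fin n → ℕ
  full q j = if toℕ j <ᵇ q then m else 0

  -- r at position i and m at the first q positions other than i (the paper's x^(i), by xprof-canonical).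
  canonical : ∀ {n} → ℕ → ℕ → Fin n → Fin n → ℕ
  canonical q       r zero    = r ∷ full q
  canonical zero    r (suc i) = 0 ∷ canonical zero r i
  canonical (suc q) r (suc i) = m ∷ canonical q r i

  full-≤ : ∀ {n} q (j : Fin n) → full q j ≤ m
  full-≤ q j with toℕ j <ᵇ q
  ... | true  = ℕ.≤-refl
  ... | false = z≤n

  canonical-≤ : ∀ {n} {r} → r ≤ m → ∀ q (i j : Fin n) → canonical q r i j ≤ m
  canonical-≤ r≤m q       zero    zero    = r≤m
  canonical-≤ r≤m q       zero    (suc j) = full-≤ q j
  canonical-≤ r≤m zero    (suc i) zero    = z≤n
  canonical-≤ r≤m zero    (suc i) (suc j) = canonical-≤ r≤m zero i j
  canonical-≤ r≤m (suc q) (suc i) zero    = ℕ.≤-refl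
  canonical-≤ r≤m (suc q) (suc i) (suc j) = canonical-≤ r≤m q i j

  sumℕ-full : ∀ {n} q → q ≤ n → sumℕ (full {n} q) ≡ q * m
  sumℕ-full {zero}  zero    _         = refl
  sumℕ-full {suc n} zero    _         = sumℕ-full {n} zero z≤n
  sumℕ-full {suc n} (suc q) (s≤s q≤n) = cong (m +_) (sumℕ-full q q≤n)

  sumℕ-canonical : ∀ {n} q r (i : Fin (suc n)) → q ≤ n → sumℕ (canonical q r i) ≡ q * m + r
  sumℕ-canonical q r zero q≤n = trans (cong (r +_) (sumℕ-full q q≤n)) (ℕ.+-comm r (q * m))
  sumℕ-canonical {suc n} zero r (suc i) _ = sumℕ-canonical zero r i z≤n
  sumℕ-canonical {suc n} (suc q) r (suc i) (s≤s q≤n) =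
    trans (cong (m +_) (sumℕ-canonical q r i q≤n)) (sym (ℕ.+-assoc m (q * m) r))

  canonical-zero : ∀ {n} r (i j : Fin n) → canonical 0 r i j ≡ (if toℕ j ≡ᵇ toℕ i then r else 0)
  canonical-zero r zero    zero    = refl
  canonical-zero r zero    (suc j) = refl
  canonical-zero r (suc i) zero    = refl
  canonical-zero r (suc i) (suc j) = canonical-zero r i j

  -- The right-hand side is xprof m q r i j with every decision replaced by its boolean test.
  canonical-spec : ∀ {n} q r (i j : Fin n) →
    canonical q r i j ≡ (if toℕ j ≡ᵇ toℕ i then r
                         else (if toℕ i ≤ᵇ q then (if toℕ j ≤ᵇ q then m else 0) else full q j))
  canonical-spec q       r zero    zero    = refl
  canonical-spec q       r zero    (suc j) = refl
  canonical-spec zero    r (suc i) zero    = refl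
  canonical-spec zero    r (suc i) (suc j) = canonical-zero r i j
  canonical-spec (suc q) r (suc i) zero    = sym (if-eta (toℕ i <ᵇ suc q))
  canonical-spec (suc q) r (suc i) (suc j)
    rewrite <ᵇ-suc (toℕ i) q | <ᵇ-suc (toℕ j) q = canonical-spec q r i j

  -- ⌊_⌋ does not reduce on open terms (unlike does), hence the rewriting.
  xprof-canonical : ∀ {n} q r (i j : Fin n) → xprof m q r i j ≡ canonical q r i j
  xprof-canonical q r i j
    rewrite isYes≗does (toℕ j ℕ.≟ toℕ i) | isYes≗does (toℕ i ≤? q)
          | isYes≗does (toℕ j ≤? q) | isYes≗does (toℕ j <? q) = sym (canonical-spec q r i j)

  -- q ≤ n is needed: otherwise the right-hand side has one more full entry, and R j m may be negative.
  full-shift : ∀ {n} {R : Fin (suc n) → ℕ → ℚ} → Ranked R →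
               ∀ q → q ≤ n → value (tail R) (full q) ≤ℚ value R (full q)
  full-shift ranked zero _ = ℚ.≤-reflexive (sym (value-idle-head ranked (full 0) refl))
  full-shift {suc n} ranked (suc q) (s≤s q≤n) =
    ℚ.+-mono-≤ (Ranked.decreasing ranked zero (suc zero) z≤n) (full-shift (ranked-tail ranked) q q≤n)

  canonical-shift : ∀ {n} {R : Fin (suc (suc n)) → ℕ → ℚ} → Ranked R → ∀ q r (i : Fin (suc n)) →
                    q ≤ n → value (tail R) (canonical q r i) ≤ℚ value R (canonical q r (suc i))
  canonical-shift ranked zero r i _ =
    ℚ.≤-reflexive (sym (value-idle-head ranked (canonical 0 r (suc i)) refl))
  canonical-shift {suc n} {R} ranked (suc q) r zero (s≤s q≤n) = begin
    R₁ r ℚ.+ value (tail (tail R)) (full (suc q))           ≤⟨ ℚ.+-monoʳ-≤ (R₁ r) full-tail-≤ ⟩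
    R₁ r ℚ.+ (R zero m ℚ.+ value (tail (tail R)) (full q))  ≡⟨ +-rotateℚ (R₁ r) (R zero m) _ ⟩
    R zero m ℚ.+ (R₁ r ℚ.+ value (tail (tail R)) (full q))  ∎
    where
    open ℚ.≤-Reasoning
    R₁ : ℕ → ℚ
    R₁ = R (suc zero)
    full-tail-≤ : value (tail (tail R)) (full (suc q)) ≤ℚ R zero m ℚ.+ value (tail (tail R)) (full q)
    full-tail-≤ = ℚ.+-mono-≤ (Ranked.decreasing ranked zero (suc (suc zero)) z≤n)
                             (full-shift (ranked-tail (ranked-tail ranked)) q q≤n)
  canonical-shift {suc n} ranked (suc q) r (suc i) (s≤s q≤n) =
    ℚ.+-mono-≤ (Ranked.decreasing ranked zero (suc zero) z≤n)
               (canonical-shift (ranked-tail ranked) q r i q≤n)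

  module _ .{{_ : NonZero m}} where

    m+s≡q*m⇒s≡q′*m : ∀ {s} q → m + s ≡ q * m → ∃ λ q′ → q ≡ suc q′ × s ≡ q′ * m
    m+s≡q*m⇒s≡q′*m zero    m+s≡0    = ⊥-elim (≢-nonZero⁻¹ m (ℕ.m+n≡0⇒m≡0 m m+s≡0))
    m+s≡q*m⇒s≡q′*m (suc q) m+s≡m+qm = q , refl , ℕ.+-cancelˡ-≡ m _ _ m+s≡m+qm

    full-greedy : ∀ {n} {R : Fin n → ℕ → ℚ} → Ranked R →
                  (w : Fin n → ℕ) → (∀ j → Extremal (w j)) →
                  ∀ q → sumℕ w ≡ q * m → value R w ≤ℚ value R (full q)
    full-greedy {zero} _ _ _ _ _ = ℚ.≤-refl
    full-greedy {suc n} {R} ranked w extremal q sum with extremal zero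
    ... | inj₁ w0≡0 = begin
      value R w                ≡⟨ value-idle-head ranked w w0≡0 ⟩
      value (tail R) (tail w)  ≤⟨ full-greedy (ranked-tail ranked) (tail w) (extremal ∘ suc) q sum′ ⟩
      value (tail R) (full q)  ≤⟨ full-shift ranked q q≤n ⟩
      value R (full q)         ∎
      where
      open ℚ.≤-Reasoning
      sum′ : sumℕ (tail w) ≡ q * m
      sum′ = trans (sym (sumℕ-head w w0≡0)) sum
      q≤n : q ≤ n
      q≤n = ℕ.*-cancelʳ-≤ q n m
              (subst (_≤ n * m) sum′ (sumℕ-≤ (tail w) (extremal⇒≤ ∘ extremal ∘ suc)))
    ... | inj₂ w0≡m with m+s≡q*m⇒s≡q′*m q (trans (sym (sumℕ-head w w0≡m)) sum)
    ...   | q′ , refl , sum′ = begin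
      value R w                             ≡⟨ value-head R w w0≡m ⟩
      R zero m ℚ.+ value (tail R) (tail w)  ≤⟨ ℚ.+-monoʳ-≤ (R zero m) tail-≤ ⟩
      value R (full (suc q′))               ∎
      where
      open ℚ.≤-Reasoning
      tail-≤ : value (tail R) (tail w) ≤ℚ value (tail R) (full q′)
      tail-≤ = full-greedy (ranked-tail ranked) (tail w) (extremal ∘ suc) q′ sum′

    canonical-greedy : ∀ {n} {R : Fin n → ℕ → ℚ} → Ranked R → (z : Fin n → ℕ) (i : Fin n) →
                       (∀ j → z j ≤ m) → ExtremalExcept i z → ∀ q →
                       sumℕ (updateAt z i (const 0)) ≡ q * m → value R z ≤ℚ value R (canonical q (z i) i)
    canonical-greedy {R = R} ranked z zero _ extremal q sum =
      ℚ.+-monoʳ-≤ (R zero (z zero))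
                  (full-greedy (ranked-tail ranked) (tail z) (λ j → extremal (suc j) (λ ())) q sum)
    canonical-greedy {suc (suc n)} {R} ranked z (suc i) bounded extremal q sum with extremal zero (λ ())
    ... | inj₁ z0≡0 = begin
      value R z                                   ≡⟨ value-idle-head ranked z z0≡0 ⟩
      value (tail R) (tail z)                     ≤⟨ tail-≤ ⟩
      value (tail R) (canonical q (z (suc i)) i)  ≤⟨ canonical-shift ranked q (z (suc i)) i q≤n ⟩
      value R (canonical q (z (suc i)) (suc i))   ∎
      where
      open ℚ.≤-Reasoning
      sum′ : sumℕ (updateAt (tail z) i (const 0)) ≡ q * m
      sum′ = trans (sym (sumℕ-head (updateAt z (suc i) (const 0)) z0≡0)) sum
      q≤n : q ≤ n
      q≤n = ℕ.*-cancelʳ-≤ q n m (subst (_≤ n * m) sum′ (sumℕ-others-≤ (tail z) i (bounded ∘ suc)))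
      tail-≤ : value (tail R) (tail z) ≤ℚ value (tail R) (canonical q (z (suc i)) i)
      tail-≤ = canonical-greedy (ranked-tail ranked) (tail z) i (bounded ∘ suc)
                                (extremalExcept-tail extremal) q sum′
    ... | inj₂ z0≡m
      with m+s≡q*m⇒s≡q′*m q (trans (sym (sumℕ-head (updateAt z (suc i) (const 0)) z0≡m)) sum)
    ...   | q′ , refl , sum′ = begin
      value R z                                         ≡⟨ value-head R z z0≡m ⟩
      R zero m ℚ.+ value (tail R) (tail z)              ≤⟨ ℚ.+-monoʳ-≤ (R zero m) tail-≤ ⟩
      value R (canonical (suc q′) (z (suc i)) (suc i))  ∎
      where
      open ℚ.≤-Reasoning
      tail-≤ : value (tail R) (tail z) ≤ℚ value (tail R) (canonical q′ (z (suc i)) i)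
      tail-≤ = canonical-greedy (ranked-tail ranked) (tail z) i (bounded ∘ suc)
                                (extremalExcept-tail extremal) q′ sum′

    [a+cm]%m≡a×[a+cm]/m≡c : ∀ a c → a ≤ m → (a + c * m) % m ≢ 0 →
                            (a + c * m) % m ≡ a × (a + c * m) / m ≡ c
    [a+cm]%m≡a×[a+cm]/m≡c a c a≤m residue≢0 =
      trans residue≡ (m<n⇒m%n≡m a<m) ,
      trans (+-distrib-/-∣ʳ a (divides-refl c)) (cong₂ _+_ (m<n⇒m/n≡0 a<m) (m*n/n≡m c m))
      where
      residue≡ : (a + c * m) % m ≡ a % m
      residue≡ = [m+kn]%n≡m%n a c m
      a<m : a < m
      a<m = ℕ.≤∧≢⇒< a≤m λ { refl → residue≢0 (trans residue≡ (n%n≡0 m)) }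

    canonical-dominates : ∀ {n} {R : Fin (suc n) → ℕ → ℚ} → Ranked R → (∀ j → Convex m (R j)) →
                          ∀ k → k % m ≢ 0 → (y : Fin (suc n) → ℕ) → IsProfile m k y →
                          ∃ λ i → value R y ≤ℚ value R (canonical (k / m) (k % m) i)
    canonical-dominates {R = R} ranked convex k k%m≢0 y (y≤m , sum-y) =
      i , ℚ.≤-trans dominates
            (subst₂ (λ q r → value R z ≤ℚ value R (canonical q r i)) (sym quotient) (sym residue)
                    (canonical-greedy ranked z i bounded extremal c others))
      where
      open Concentration (concentrate R convex y y≤m) renaming (profile to z; fractional to i)
      counted : ∃ λ c → sumℕ (updateAt z i (const 0)) ≡ c * m
      counted = sumℕ-extremal (updateAt z i (const 0)) (updateAt-preserves Extremal i extremal (inj₁ refl))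
      c : ℕ
      c = proj₁ counted
      others : sumℕ (updateAt z i (const 0)) ≡ c * m
      others = proj₂ counted
      k≡ : k ≡ z i + c * m
      k≡ = begin
        k                                   ≡⟨ sum-y ⟨
        sumℕ y                              ≡⟨ total ⟨
        sumℕ z                              ≡⟨ sumℕ-updateAt 0 (z i) z i 0 (sym (ℕ.+-identityʳ (z i))) ⟩
        z i + sumℕ (updateAt z i (const 0)) ≡⟨ cong (z i +_) others ⟩
        z i + c * m                         ∎
        where open ≡-Reasoning
      divmod : (z i + c * m) % m ≡ z i × (z i + c * m) / m ≡ c
      divmod = [a+cm]%m≡a×[a+cm]/m≡c (z i) c (bounded i) (subst (λ x → x % m ≢ 0) k≡ k%m≢0)
      residue : k % m ≡ z i
      residue = trans (cong (_% m) k≡) (proj₁ divmod)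
      quotient : k / m ≡ c
      quotient = trans (cong (_/ m) k≡) (proj₂ divmod)

    k≤n*m∧k%m≢0⇒k/m<n : ∀ {n k} → k ≤ n * m → k % m ≢ 0 → k / m < n
    k≤n*m∧k%m≢0⇒k/m<n {n} {k} k≤nm k%m≢0 = ℕ.*-cancelʳ-< m (k / m) n (begin-strict
      k / m * m          <⟨ ℕ.m<n+m (k / m * m) (ℕ.n≢0⇒n>0 k%m≢0) ⟩
      k % m + k / m * m  ≡⟨ m≡m%n+[m/n]*n k m ⟨
      k                  ≤⟨ k≤nm ⟩
      n * m              ∎)
      where open ℕ.≤-Reasoning

lemma5 : (n m : ℕ) → .{{_ : NonZero m}} → 1 ≤ n →
    (R : Fin n → ℕ → ℚ) →
    (∀ j → Convex m (R j)) →
    (∀ j → R j 0 ≡ 0ℚ) →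
    (∀ i j → toℕ i ≤ toℕ j → R j m ≤ℚ R i m) →
    (k : ℕ) → 1 ≤ k → k ≤ n * m → k % m ≢ 0 →
    ∃ λ (i : Fin n) → IsOptimal R m k (xprof m (k / m) (k % m) i)
lemma5 (suc n) m _ R convex vanishes decreasing k _ k≤nm k%m≢0 =
  i , IsOptimal-resp R (λ j → sym (xprof-canonical m q r i j)) (canonical-profile , optimal)
  where
  q r : ℕ
  q = k / m
  r = k % m
  ranked : Ranked m R
  ranked = record { vanishes = vanishes ; decreasing = decreasing }
  best : ∃ λ i → ∀ j → value R (canonical m q r j) ≤ℚ value R (canonical m q r i)
  best = argmax (λ j → value R (canonical m q r j))
  i : Fin (suc n)
  i = proj₁ best
  canonical-profile : IsProfile m k (canonical m q r i)
  canonical-profile =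
    canonical-≤ m (ℕ.<⇒≤ (m%n<n k m)) q i ,
    trans (sumℕ-canonical m q r i (s≤s⁻¹ (k≤n*m∧k%m≢0⇒k/m<n m k≤nm k%m≢0)))
          (trans (ℕ.+-comm (q * m) r) (sym (m≡m%n+[m/n]*n k m)))
  optimal : ∀ y → IsProfile m k y → value R y ≤ℚ value R (canonical m q r i)
  optimal y y-profile with canonical-dominates m ranked convex k k%m≢0 y y-profile
  ... | j , y≤j = ℚ.≤-trans y≤j (proj₂ best j)
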